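{- Let $q,t$ be integers (or indeterminates). For all $m\ge2$, $$\begin{pmatrix}1+q+t&1\\-q&0\end{pmatrix}^m=\begin{pmatrix}\hat{F}_{2m}&\hat{F}_{2m-2}\\-q\hat{F}_{2m-2}&-q\hat{F}_{2m-4}\end{pmatrix}.$$
   Context: For $n\ge0$, $\hat{F}_{2n}(q,t)=\sum_{S}q^{\#\{\text{even elements of }S\}}\,t^{\,n-\#S}$, the sum over all subsets $S\subseteq\{1,2,\dots,2n\}$ containing no two consecutive integers (so $\hat{F}_0=1$, $\hat{F}_2=1+q+t$). -}

module Defs where

open import Data.Nat using (ℕ; zero; suc; _∸_)
open import Data.Bool using (Bool; true; false; if_then_else_; _∧_)
open import Data.List using (List; []; _∷_; map; filter; _++_; foldr)
open import Data.Integer using (ℤ; _+_; _*_; -_; _^_; 0ℤ; 1ℤ)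
open import Data.Fin using (Fin; zero; suc)
open import Data.Integer using (+_)

-- Subsets of {1,...,k} encoded as length-k lists of Bools:
-- the i-th entry (1-indexed) is true iff i ∈ S.
allSubsets : ℕ → List (List Bool)
allSubsets zero = [] ∷ []
allSubsets (suc k) = map (false ∷_) (allSubsets k) ++ map (true ∷_) (allSubsets k)

noConsec : List Bool → Bool
noConsec [] = true
noConsec (true ∷ true ∷ _) = false
noConsec (_ ∷ rest) = noConsec rest

isEven : ℕ → Bool
isEven zero = true
isEven (suc n) = if isEven n then false else true

card : List Bool → ℕ
card [] = 0
card (true ∷ s) = suc (card s)
card (false ∷ s) = card s

-- number of even elements of S, where the head of the list is position p
evenFrom : ℕ → List Bool → ℕ
evenFrom p [] = 0
evenFrom p (b ∷ s) = if b ∧ isEven p then suc (evenFrom (suc p) s) else evenFrom (suc p) s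

evenCount : List Bool → ℕ
evenCount = evenFrom 1

sumℤ : List ℤ → ℤ
sumℤ = foldr _+_ 0ℤ

-- Fhat n q t = \hat F_{2n}(q,t) = Σ_{S ⊆ {1..2n}, no two consecutive} q^{#even S} t^{n - #S}
Fhat : ℕ → ℤ → ℤ → ℤ
Fhat n q t = sumℤ (map (λ S → q ^ evenCount S * t ^ (n ∸ card S))
                       (filter (λ S → noConsec S Data.Bool.≟ true) (allSubsets (n Data.Nat.+ n))))

Mat2 : Set
Mat2 = Fin 2 → Fin 2 → ℤ

_⊗_ : Mat2 → Mat2 → Mat2
(A ⊗ B) i j = A i zero * B zero j + A i (suc zero) * B (suc zero) j

idM : Mat2
idM zero zero = 1ℤ
idM zero (suc zero) = 0ℤ
idM (suc zero) zero = 0ℤ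
idM (suc zero) (suc zero) = 1ℤ

_^M_ : Mat2 → ℕ → Mat2
A ^M zero = idM
A ^M suc m = A ⊗ (A ^M m)

Mqt : ℤ → ℤ → Mat2
Mqt q t zero zero = 1ℤ + q + t
Mqt q t zero (suc zero) = 1ℤ
Mqt q t (suc zero) zero = - q
Mqt q t (suc zero) (suc zero) = 0ℤ

Rhs : ℕ → ℤ → ℤ → Mat2
Rhs m q t zero zero = Fhat m q t
Rhs m q t zero (suc zero) = Fhat (m ∸ 1) q t
Rhs m q t (suc zero) zero = - q * Fhat (m ∸ 1) q t
Rhs m q t (suc zero) (suc zero) = - q * Fhat (m ∸ 2) q t

-- A set S ⊆ {1,…,2n+2} without two consecutive elements meets {1,2} in ∅, {1} or {2}.
-- Removing {1,2} leaves a set of the same kind in {3,…,2n+2} ≅ {1,…,2n} (a shift by two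
-- preserves parity), the three cases contributing t F̂_{2n}, F̂_{2n} and q Ĝ_{2n}, where
-- Ĝ_{2n} is the sum over those S with 1 ∉ S; likewise Ĝ_{2n+2} = t F̂_{2n} + q Ĝ_{2n}.
-- Eliminating Ĝ gives F̂_{2n+4} = (1+q+t) F̂_{2n+2} − q F̂_{2n}, and every sequence with
-- this recurrence is read off the powers of the companion matrix of x² − (1+q+t)x + q.
module Submission where

open import Defs
open import Data.Nat using (ℕ; _≤_)
open import Data.Integer using (ℤ)
open import Data.Fin using (Fin)
open import Relation.Binary.PropositionalEquality using (_≡_)

open import Function using (_∘′_)
open import Data.Bool using (Bool; true; false; if_then_else_; _≟_)
open import Data.Fin using (zero; suc)
import Data.Nat as Nat
open Nat using (zero; suc; _∸_; z≤n; s≤s)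
import Data.Nat.Properties as ℕₚ
open import Data.Integer using (_+_; _*_; -_; _-_; _^_; 0ℤ; 1ℤ)
import Data.Integer.Properties as ℤₚ
open import Data.Integer.Tactic.RingSolver using (solve-∀)
open import Algebra.Properties.CommutativeSemigroup ℤₚ.*-commutativeSemigroup using (x∙yz≈y∙xz)
open import Data.List using (List; []; _∷_; map; filter; _++_; length)
open import Data.List.Relation.Unary.All as All using (All; []; _∷_)
import Data.List.Relation.Unary.All.Properties as Allₚ
open import Relation.Binary.PropositionalEquality
  using (refl; sym; trans; cong; cong₂; module ≡-Reasoning)

private variable
  A B : Set

sumWhere : (A → Bool) → (A → ℤ) → List A → ℤ
sumWhere p g []       = 0ℤ
sumWhere p g (x ∷ xs) = (if p x then g x else 0ℤ) + sumWhere p g xs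

sumℤ-map-filter : ∀ (p : A → Bool) (g : A → ℤ) xs →
                  sumℤ (map g (filter (λ x → p x ≟ true) xs)) ≡ sumWhere p g xs
sumℤ-map-filter p g []       = refl
sumℤ-map-filter p g (x ∷ xs) with p x
... | true  = cong (g x +_) (sumℤ-map-filter p g xs)
... | false = trans (sumℤ-map-filter p g xs) (sym (ℤₚ.+-identityˡ _))

sumWhere-++ : ∀ (p : A → Bool) (g : A → ℤ) xs ys →
              sumWhere p g (xs ++ ys) ≡ sumWhere p g xs + sumWhere p g ys
sumWhere-++ p g []       ys = sym (ℤₚ.+-identityˡ _)
sumWhere-++ p g (x ∷ xs) ys = trans (cong (gₓ +_) (sumWhere-++ p g xs ys))
                                    (sym (ℤₚ.+-assoc gₓ (sumWhere p g xs) (sumWhere p g ys)))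
  where gₓ = if p x then g x else 0ℤ

sumWhere-map : ∀ (p : A → Bool) (g : A → ℤ) (f : B → A) xs →
               sumWhere p g (map f xs) ≡ sumWhere (p ∘′ f) (g ∘′ f) xs
sumWhere-map p g f []       = refl
sumWhere-map p g f (x ∷ xs) = cong ((if p (f x) then g (f x) else 0ℤ) +_) (sumWhere-map p g f xs)

sumWhere-cong : ∀ {P : A → Set} {p : A → Bool} {g h : A → ℤ} {xs} → All P xs →
                (∀ {x} → P x → p x ≡ true → g x ≡ h x) →
                sumWhere p g xs ≡ sumWhere p h xs
sumWhere-cong {p = p} {xs = x ∷ _} (Px ∷ Pxs) g≡h with p x in px
... | true  = cong₂ _+_ (g≡h Px px) (sumWhere-cong Pxs g≡h)
... | false = cong (0ℤ +_) (sumWhere-cong Pxs g≡h)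
sumWhere-cong [] g≡h = refl

sumWhere-*ˡ : ∀ (p : A → Bool) (g : A → ℤ) k xs →
              sumWhere p (λ x → k * g x) xs ≡ k * sumWhere p g xs
sumWhere-*ˡ p g k []       = sym (ℤₚ.*-zeroʳ k)
sumWhere-*ˡ p g k (x ∷ xs) with p x
... | true  = trans (cong (k * g x +_) (sumWhere-*ˡ p g k xs)) (sym (ℤₚ.*-distribˡ-+ k _ _))
... | false = begin
  0ℤ + sumWhere p (λ x → k * g x) xs  ≡⟨ ℤₚ.+-identityˡ _ ⟩
  sumWhere p (λ x → k * g x) xs       ≡⟨ sumWhere-*ˡ p g k xs ⟩
  k * sumWhere p g xs                 ≡⟨ cong (k *_) (ℤₚ.+-identityˡ _) ⟨
  k * (0ℤ + sumWhere p g xs)          ∎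
  where open ≡-Reasoning

sumWhere-never : ∀ (g : A → ℤ) xs → sumWhere (λ _ → false) g xs ≡ 0ℤ
sumWhere-never g []       = refl
sumWhere-never g (x ∷ xs) = trans (ℤₚ.+-identityˡ _) (sumWhere-never g xs)

allSubsets-length : ∀ k → All (λ S → length S ≡ k) (allSubsets k)
allSubsets-length zero    = refl ∷ []
allSubsets-length (suc k) = Allₚ.++⁺ (Allₚ.map⁺ (All.map (cong suc) (allSubsets-length k)))
                                     (Allₚ.map⁺ (All.map (cong suc) (allSubsets-length k)))

allSubsets₂ : ℕ → List (List Bool)
allSubsets₂ n = allSubsets (n Nat.+ n)

sumWhere-allSubsets-suc : ∀ k p g → sumWhere p g (allSubsets (suc k)) ≡
  sumWhere (p ∘′ (false ∷_)) (g ∘′ (false ∷_)) (allSubsets k) +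
  sumWhere (p ∘′ (true ∷_)) (g ∘′ (true ∷_)) (allSubsets k)
sumWhere-allSubsets-suc k p g =
  trans (sumWhere-++ p g (map (false ∷_) (allSubsets k)) (map (true ∷_) (allSubsets k)))
        (cong₂ _+_ (sumWhere-map p g (false ∷_) (allSubsets k))
                   (sumWhere-map p g (true ∷_) (allSubsets k)))

sumWhere-allSubsets₂-suc : ∀ n p g → sumWhere p g (allSubsets₂ (suc n)) ≡
  (sumWhere (p ∘′ (λ S → false ∷ false ∷ S)) (g ∘′ (λ S → false ∷ false ∷ S)) (allSubsets₂ n) +
   sumWhere (p ∘′ (λ S → false ∷ true ∷ S)) (g ∘′ (λ S → false ∷ true ∷ S)) (allSubsets₂ n)) +
  (sumWhere (p ∘′ (λ S → true ∷ false ∷ S)) (g ∘′ (λ S → true ∷ false ∷ S)) (allSubsets₂ n) +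
   sumWhere (p ∘′ (λ S → true ∷ true ∷ S)) (g ∘′ (λ S → true ∷ true ∷ S)) (allSubsets₂ n))
sumWhere-allSubsets₂-suc n p g rewrite ℕₚ.+-suc n n =
  trans (sumWhere-allSubsets-suc (suc (n Nat.+ n)) p g)
        (cong₂ _+_ (sumWhere-allSubsets-suc (n Nat.+ n) _ _)
                   (sumWhere-allSubsets-suc (n Nat.+ n) _ _))

isEven-+2 : ∀ p → isEven (suc (suc p)) ≡ isEven p
isEven-+2 p with isEven p
... | true  = refl
... | false = refl

evenFrom-+2 : ∀ p S → evenFrom (suc (suc p)) S ≡ evenFrom p S
evenFrom-+2 p []          = refl
evenFrom-+2 p (false ∷ S) = evenFrom-+2 (suc p) S
evenFrom-+2 p (true ∷ S) rewrite isEven-+2 p with isEven p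
... | true  = cong suc (evenFrom-+2 (suc p) S)
... | false = evenFrom-+2 (suc p) S

card+card≤1+length : ∀ S → noConsec S ≡ true → card S Nat.+ card S ≤ suc (length S)
card+card≤1+length []                 _  = z≤n
card+card≤1+length (false ∷ S)        nc = ℕₚ.m≤n⇒m≤1+n (card+card≤1+length S nc)
card+card≤1+length (true ∷ [])        _  = s≤s (s≤s z≤n)
card+card≤1+length (true ∷ false ∷ S) nc rewrite ℕₚ.+-suc (card S) (card S) =
  s≤s (s≤s (card+card≤1+length S nc))

half-≤ : ∀ {c n} → c Nat.+ c ≤ suc (n Nat.+ n) → c ≤ n
half-≤ {c} {n} 2c≤2n+1 = ℕₚ.≮⇒≥ λ n<c →
  ℕₚ.1+n≰n (ℕₚ.+-cancelˡ-≤ n _ _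
    (ℕₚ.+-cancelˡ-≤ 1 _ _ (ℕₚ.≤-trans (ℕₚ.+-mono-≤ n<c n<c) 2c≤2n+1)))

card≤half : ∀ S {n} → noConsec S ≡ true → length S ≡ n Nat.+ n → card S ≤ n
card≤half S nc len =
  half-≤ (ℕₚ.≤-trans (card+card≤1+length S nc) (ℕₚ.≤-reflexive (cong suc len)))

module _ (q t : ℤ) where

  weight : ℕ → List Bool → ℤ
  weight n S = q ^ evenCount S * t ^ (n ∸ card S)

  F G : ℕ → ℤ
  F n = sumWhere noConsec (weight n) (allSubsets₂ n)
  -- the sum over those S with 1 ∉ S, i.e. with {0} ∪ S still free of consecutive elements
  G n = sumWhere (noConsec ∘′ (true ∷_)) (weight n) (allSubsets₂ n)

  -- Needs card S ≤ n, since ∸ truncates: only then is (n + 1) ∸ card S = 1 + (n ∸ card S).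
  weight-∉1∉2 : ∀ n S → length S ≡ n Nat.+ n → noConsec S ≡ true →
                weight (suc n) (false ∷ false ∷ S) ≡ t * weight n S
  weight-∉1∉2 n S len nc = begin
    q ^ evenFrom 3 S * t ^ (suc n ∸ card S)
      ≡⟨ cong₂ (λ e k → q ^ e * t ^ k) (evenFrom-+2 1 S)
               (ℕₚ.+-∸-assoc 1 (card≤half S nc len)) ⟩
    q ^ evenCount S * (t * t ^ (n ∸ card S))
      ≡⟨ x∙yz≈y∙xz (q ^ evenCount S) t (t ^ (n ∸ card S)) ⟩
    t * weight n S
      ∎
    where open ≡-Reasoning

  weight-∉1∈2 : ∀ n S → weight (suc n) (false ∷ true ∷ S) ≡ q * weight n S
  weight-∉1∈2 n S = trans (cong (λ e → q ^ suc e * t ^ (n ∸ card S)) (evenFrom-+2 1 S))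
                          (ℤₚ.*-assoc q (q ^ evenCount S) (t ^ (n ∸ card S)))

  weight-∈1∉2 : ∀ n S → weight (suc n) (true ∷ false ∷ S) ≡ weight n S
  weight-∈1∉2 n S = cong (λ e → q ^ e * t ^ (n ∸ card S)) (evenFrom-+2 1 S)

  sum-∉1∉2 : ∀ n → sumWhere noConsec (weight (suc n) ∘′ (λ S → false ∷ false ∷ S)) (allSubsets₂ n)
                   ≡ t * F n
  sum-∉1∉2 n = trans (sumWhere-cong (allSubsets-length (n Nat.+ n)) (λ {S} → weight-∉1∉2 n S))
                     (sumWhere-*ˡ noConsec (weight n) t (allSubsets₂ n))

  sum-∉1∈2 : ∀ n → sumWhere (noConsec ∘′ (true ∷_)) (weight (suc n) ∘′ (λ S → false ∷ true ∷ S))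
                            (allSubsets₂ n)
                   ≡ q * G n
  sum-∉1∈2 n = trans (sumWhere-cong (allSubsets-length (n Nat.+ n))
                                    (λ {S} _ _ → weight-∉1∈2 n S))
                     (sumWhere-*ˡ (noConsec ∘′ (true ∷_)) (weight n) q (allSubsets₂ n))

  sum-∈1∉2 : ∀ n → sumWhere noConsec (weight (suc n) ∘′ (λ S → true ∷ false ∷ S)) (allSubsets₂ n)
                   ≡ F n
  sum-∈1∉2 n = sumWhere-cong (allSubsets-length (n Nat.+ n)) (λ {S} _ _ → weight-∈1∉2 n S)

  F-suc : ∀ n → F (suc n) ≡ t * F n + q * G n + F n
  F-suc n = trans (sumWhere-allSubsets₂-suc n noConsec (weight (suc n)))
    (cong₂ _+_ (cong₂ _+_ (sum-∉1∉2 n) (sum-∉1∈2 n))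
               (trans (cong₂ _+_ (sum-∈1∉2 n) (sumWhere-never _ (allSubsets₂ n)))
                      (ℤₚ.+-identityʳ (F n))))

  G-suc : ∀ n → G (suc n) ≡ t * F n + q * G n
  G-suc n = trans (sumWhere-allSubsets₂-suc n (noConsec ∘′ (true ∷_)) (weight (suc n)))
    (trans (cong₂ _+_ (cong₂ _+_ (sum-∉1∉2 n) (sum-∉1∈2 n))
                      (cong₂ _+_ (sumWhere-never _ (allSubsets₂ n))
                                 (sumWhere-never _ (allSubsets₂ n))))
           (ℤₚ.+-identityʳ _))

  G-suc-F : ∀ n → G (suc n) ≡ F (suc n) - F n
  G-suc-F n = begin
    G (suc n)                      ≡⟨ G-suc n ⟩
    t * F n + q * G n              ≡⟨ x≡x+y-y _ (F n) ⟩
    t * F n + q * G n + F n - F n  ≡⟨ cong (_- F n) (F-suc n) ⟨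
    F (suc n) - F n                ∎
    where
    open ≡-Reasoning
    x≡x+y-y : ∀ x y → x ≡ x + y - y
    x≡x+y-y = solve-∀

  F-recurrence : ∀ n → F (suc (suc n)) ≡ (1ℤ + q + t) * F (suc n) + - q * F n
  F-recurrence n = begin
    F (suc (suc n))                                    ≡⟨ F-suc (suc n) ⟩
    t * F (suc n) + q * G (suc n) + F (suc n)
      ≡⟨ cong (λ g → t * F (suc n) + q * g + F (suc n)) (G-suc-F n) ⟩
    t * F (suc n) + q * (F (suc n) - F n) + F (suc n)  ≡⟨ eliminate q t (F (suc n)) (F n) ⟩
    (1ℤ + q + t) * F (suc n) + - q * F n               ∎
    where
    open ≡-Reasoning
    eliminate : ∀ q t x y → t * x + q * (x - y) + x ≡ (1ℤ + q + t) * x + - q * y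
    eliminate = solve-∀

  F-one : F 1 ≡ 1ℤ + q + t
  F-one = trans (F-suc 0) (lemma q t)
    where lemma : ∀ q t → t * 1ℤ + q * 1ℤ + 1ℤ ≡ 1ℤ + q + t
          lemma = solve-∀

  Fhat≡F : ∀ n → Fhat n q t ≡ F n
  Fhat≡F n = sumℤ-map-filter noConsec (weight n) (allSubsets₂ n)

_≗ᴹ_ : Mat2 → Mat2 → Set
M ≗ᴹ N = ∀ i j → M i j ≡ N i j

⊗-cong : ∀ {M M′ N N′} → M ≗ᴹ M′ → N ≗ᴹ N′ → (M ⊗ N) ≗ᴹ (M′ ⊗ N′)
⊗-cong M≗M′ N≗N′ i j =
  cong₂ _+_ (cong₂ _*_ (M≗M′ i zero) (N≗N′ zero j))
            (cong₂ _*_ (M≗M′ i (suc zero)) (N≗N′ (suc zero) j))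

^M-cong : ∀ {M N} → M ≗ᴹ N → ∀ m → (M ^M m) ≗ᴹ (N ^M m)
^M-cong M≗N zero    i j = refl
^M-cong M≗N (suc m) i j = ⊗-cong M≗N (^M-cong M≗N m) i j

⊗-identityʳ : ∀ M → (M ⊗ idM) ≗ᴹ M
⊗-identityʳ M i zero       = lemma (M i zero) (M i (suc zero))
  where lemma : ∀ x y → x * 1ℤ + y * 0ℤ ≡ x
        lemma = solve-∀
⊗-identityʳ M i (suc zero) = lemma (M i zero) (M i (suc zero))
  where lemma : ∀ x y → x * 0ℤ + y * 1ℤ ≡ y
        lemma = solve-∀

companion : ℤ → ℤ → Mat2
companion a b zero       zero       = a
companion a b zero       (suc zero) = 1ℤ
companion a b (suc zero) zero       = b
companion a b (suc zero) (suc zero) = 0ℤ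

-- companion a b ^M m has this shape with (x , y , z) = (f m , f (m − 1) , f (m − 2)),
-- where f (n + 2) = a f (n + 1) + b f n, f 0 = 1 and f 1 = a.
window : ℤ → ℤ → ℤ → ℤ → Mat2
window b x y z zero       zero       = x
window b x y z zero       (suc zero) = y
window b x y z (suc zero) zero       = b * y
window b x y z (suc zero) (suc zero) = b * z

companion-⊗-window : ∀ {a b w x y z} → w ≡ a * x + b * y → x ≡ a * y + b * z →
                     (companion a b ⊗ window b x y z) ≗ᴹ window b w x y
companion-⊗-window {a} {b} {x = x} {y} {z} w≡ x≡ = λ where
  zero       zero       → trans (cong (a * x +_) (ℤₚ.*-identityˡ (b * y))) (sym w≡)
  zero       (suc zero) → trans (cong (a * y +_) (ℤₚ.*-identityˡ (b * z))) (sym x≡)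
  (suc zero) zero       → ℤₚ.+-identityʳ (b * x)
  (suc zero) (suc zero) → ℤₚ.+-identityʳ (b * y)

companion-^M-suc : ∀ {a b w x y z} m → (companion a b ^M m) ≗ᴹ window b x y z →
                   w ≡ a * x + b * y → x ≡ a * y + b * z →
                   (companion a b ^M suc m) ≗ᴹ window b w x y
companion-^M-suc {a} {b} m Cᵐ≗window w≡ x≡ i j =
  trans (⊗-cong {M = companion a b} (λ _ _ → refl) Cᵐ≗window i j)
        (companion-⊗-window {a = a} w≡ x≡ i j)

module _ {a b : ℤ} (f : ℕ → ℤ) (f0 : f 0 ≡ 1ℤ) (f1 : f 1 ≡ a)
         (f-rec : ∀ n → f (suc (suc n)) ≡ a * f (suc n) + b * f n) where

  companion≗window : companion a b ≗ᴹ window b (f 1) (f 0) 0ℤ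
  companion≗window zero       zero       = sym f1
  companion≗window zero       (suc zero) = sym f0
  companion≗window (suc zero) zero       = trans (sym (ℤₚ.*-identityʳ b)) (cong (b *_) (sym f0))
  companion≗window (suc zero) (suc zero) = sym (ℤₚ.*-zeroʳ b)

  f1≡a*f0+b*0 : f 1 ≡ a * f 0 + b * 0ℤ
  f1≡a*f0+b*0 = trans f1 (trans (lemma a b) (cong (λ y → a * y + b * 0ℤ) (sym f0)))
    where lemma : ∀ a b → a ≡ a * 1ℤ + b * 0ℤ
          lemma = solve-∀

  companion-^M : ∀ k → (companion a b ^M suc (suc k)) ≗ᴹ
                       window b (f (suc (suc k))) (f (suc k)) (f k)
  companion-^M zero    = companion-^M-suc 1 companion¹≗window (f-rec 0) f1≡a*f0+b*0
    where
    companion¹≗window : (companion a b ^M 1) ≗ᴹ window b (f 1) (f 0) 0ℤ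
    companion¹≗window i j = trans (⊗-identityʳ (companion a b) i j) (companion≗window i j)
  companion-^M (suc k) = companion-^M-suc (suc (suc k)) (companion-^M k) (f-rec (suc k)) (f-rec k)

Mqt≗companion : ∀ q t → Mqt q t ≗ᴹ companion (1ℤ + q + t) (- q)
Mqt≗companion q t zero       zero       = refl
Mqt≗companion q t zero       (suc zero) = refl
Mqt≗companion q t (suc zero) zero       = refl
Mqt≗companion q t (suc zero) (suc zero) = refl

window≗Rhs : ∀ q t k → window (- q) (Fhat (suc (suc k)) q t) (Fhat (suc k) q t) (Fhat k q t)
                       ≗ᴹ Rhs (suc (suc k)) q t
window≗Rhs q t k zero       zero       = refl
window≗Rhs q t k zero       (suc zero) = refl
window≗Rhs q t k (suc zero) zero       = refl
window≗Rhs q t k (suc zero) (suc zero) = refl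

Fhat-recurrence : ∀ q t n →
  Fhat (suc (suc n)) q t ≡ (1ℤ + q + t) * Fhat (suc n) q t + - q * Fhat n q t
Fhat-recurrence q t n
  rewrite Fhat≡F q t (suc (suc n)) | Fhat≡F q t (suc n) | Fhat≡F q t n = F-recurrence q t n

Fhat-one : ∀ q t → Fhat 1 q t ≡ 1ℤ + q + t
Fhat-one q t = trans (Fhat≡F q t 1) (F-one q t)

lemma5 : (q t : ℤ) (m : ℕ) → 2 ≤ m → (i j : Fin 2) → (Mqt q t ^M m) i j ≡ Rhs m q t i j
lemma5 q t (suc (suc k)) (s≤s (s≤s z≤n)) i j = begin
  (Mqt q t ^M suc (suc k)) i j
    ≡⟨ ^M-cong (Mqt≗companion q t) (suc (suc k)) i j ⟩
  (companion (1ℤ + q + t) (- q) ^M suc (suc k)) i j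
    ≡⟨ companion-^M (λ n → Fhat n q t) refl (Fhat-one q t) (Fhat-recurrence q t) k i j ⟩
  window (- q) (Fhat (suc (suc k)) q t) (Fhat (suc k) q t) (Fhat k q t) i j
    ≡⟨ window≗Rhs q t k i j ⟩
  Rhs (suc (suc k)) q t i j
    ∎
  where open ≡-Reasoning
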